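{- Let $\mathcal{S}\subseteq E_n$. Then one can find finitely many systems $T_1,\ldots,T_m$, each consisting only of equations of the forms $\alpha+1=\gamma$ and $\alpha\cdot\beta=\gamma$ (in the variables $x_1,\ldots,x_n$ and possibly additional variables), such that for every field $F$ and every $(x_1,\ldots,x_n)\in F^n$: $(x_1,\ldots,x_n)$ solves $\mathcal{S}$ if and only if for some $i\in\{1,\ldots,m\}$ the additional variables of $T_i$ can be assigned values in $F$ so that $T_i$ holds.
   Context: For a positive integer $n$, $E_n=\{1=x_k: k\in\{1,\ldots,n\}\}\cup\{x_i+x_j=x_k: i,j,k\in\{1,\ldots,n\}\}\cup\{x_i\cdot x_j=x_k: i,j,k\in\{1,\ldots,n\}\}$; a system $\mathcal{S}\subseteq E_n$ is a set of such equations. In $\alpha+1=\gamma$ and $\alpha\cdot\beta=\gamma$, the letters $\alpha,\beta,\gamma$ denote variables. -}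

module Defs where

open import Level using (Level; _⊔_; suc; Setω)
open import Algebra.Bundles using (CommutativeRing)
open import Data.Nat using (ℕ)
open import Data.Fin using (Fin)
open import Data.Sum using (_⊎_; inj₁; inj₂; [_,_])
open import Data.Product using (Σ; ∃)
open import Data.List using (List)
open import Data.List.Relation.Unary.All using (All)
open import Relation.Nullary using (¬_)

record Field (c ℓ : Level) : Set (suc (c ⊔ ℓ)) where
  field
    commutativeRing : CommutativeRing c ℓ
  open CommutativeRing commutativeRing public
  field
    1≉0     : ¬ (1# ≈ 0#)
    inverse : ∀ x → ¬ (x ≈ 0#) → Σ Carrier (λ y → (x * y) ≈ 1#)

data Eqn (n : ℕ) : Set where
  one≡ : (k : Fin n) → Eqn n
  add≡ : (i j k : Fin n) → Eqn n
  mul≡ : (i j k : Fin n) → Eqn n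

-- A system S ⊆ E_n (E_n is finite, so S is a finite list of equations).
System : ℕ → Set
System n = List (Eqn n)

data REqn (V : Set) : Set where
  succ≡ : (α γ : V) → REqn V
  prod≡ : (α β γ : V) → REqn V

module _ {c ℓ : Level} (F : Field c ℓ) where
  open Field F

  holdsE : ∀ {n} → (Fin n → Carrier) → Eqn n → Set ℓ
  holdsE x (one≡ k)     = 1# ≈ x k
  holdsE x (add≡ i j k) = (x i + x j) ≈ x k
  holdsE x (mul≡ i j k) = (x i * x j) ≈ x k

  Solves : ∀ {n} → System n → (Fin n → Carrier) → Set ℓ
  Solves S x = All (holdsE x) S

  holdsR : ∀ {V : Set} → (V → Carrier) → REqn V → Set ℓ
  holdsR v (succ≡ α γ)   = (v α + 1#) ≈ v γ
  holdsR v (prod≡ α β γ) = (v α * v β) ≈ v γ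

  -- A restricted system with k additional variables: its variables are
  -- Fin n ⊎ Fin k (inj₁ i = x_i, inj₂ j = the j-th additional variable).
  ExtSolvable : ∀ {n k} → List (REqn (Fin n ⊎ Fin k)) → (Fin n → Carrier) → Set (c ⊔ ℓ)
  ExtSolvable {k = k} T x = Σ (Fin k → Carrier) (λ y → All (holdsR [ x , y ]) T)

RSystem : ℕ → Set
RSystem n = Σ ℕ (λ k → List (REqn (Fin n ⊎ Fin k)))

record Σω (A : Set) (B : A → Setω) : Setω where
  constructor _,ω_
  field
    fst : A
    snd : B fst

-- Julia Robinson's trick: in a commutative ring x + y = z holds iff
-- z(x + y) = z² and (z + 1)((x + 1) + y) = (z + 1)², and z(x + y) = z² holds
-- iff (xz + 1)(yz + 1) = z²(xy + 1) + 1, an equation between two expressions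
-- built from successors and products only, hence expressible with auxiliary
-- variables.  Likewise 1 = k iff some w has w + 1 = k, w² = w and wk = w.
-- Encoding each equation this way and conjoining the encodings on disjoint
-- auxiliary variables gives a single system (m = 1); no field axiom beyond
-- those of a commutative ring is used.

module Submission where

open import Defs
open import Level using (Level)
open import Algebra.Bundles using (CommutativeRing)
open import Data.Nat as ℕ using (ℕ)
open import Data.Fin using (Fin; zero; #_; splitAt; _↑ˡ_; _↑ʳ_)
open import Data.Fin.Properties using (splitAt-↑ˡ; splitAt-↑ʳ)
open import Data.List using (List; []; _∷_; map; _++_; foldr)
open import Data.List.Relation.Unary.All as All using (All; []; _∷_)
open import Data.List.Relation.Unary.All.Properties using (map⁺; map⁻; ++⁺; ++⁻)
open import Data.Product using (Σ; _×_; _,_; proj₂; uncurry)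
open import Data.Product.Function.NonDependent.Propositional using (_×-⇔_)
open import Data.Sum using (_⊎_; inj₁; inj₂; [_,_]; [_,_]′) renaming (map₂ to ⊎-map₂)
open import Data.Vec using (lookup; _∷_; [])
import Data.Vec.Functional as Vector
open import Function using (_∘_; _∘′_; _$_; id)
open import Function.Bundles using (_⇔_; mk⇔; Equivalence)
open import Function.Construct.Symmetry using (⇔-sym)
open import Function.Related.Propositional using (module EquationalReasoning)
open import Relation.Binary.PropositionalEquality as ≡ using (_≡_)
import Relation.Binary.Reasoning.Setoid as ≈-Reasoning

open Equivalence using (to; from)

module RingIdentities {c ℓ : Level} (R : CommutativeRing c ℓ) where
  open CommutativeRing R
  open import Algebra.Properties.Group +-group using (∙-cancelʳ)
  open import Algebra.Solver.Ring.NaturalCoefficients.Default commutativeSemiring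
  open import Relation.Binary.Reasoning.Setoid setoid

  Robinson : Carrier → Carrier → Carrier → Set ℓ
  Robinson a b z = z * (a + b) ≈ z * z

  Robinson-resp : ∀ {a a′ b b′ z z′} → a ≈ a′ → b ≈ b′ → z ≈ z′ →
    Robinson a b z → Robinson a′ b′ z′
  Robinson-resp a≈ b≈ z≈ h = begin
    _ ≈⟨ *-cong z≈ (+-cong a≈ b≈) ⟨
    _ ≈⟨ h ⟩
    _ ≈⟨ *-cong z≈ z≈ ⟩
    _ ∎

  robinson⇔ : ∀ a b z →
    (a * z + 1#) * (b * z + 1#) ≈ z * z * (a * b + 1#) + 1# ⇔ Robinson a b z
  robinson⇔ a b z = mk⇔
    (λ h → ∙-cancelʳ common _ _ (begin
      z * (a + b) + common         ≈⟨ lhs ⟨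
      (a * z + 1#) * (b * z + 1#)  ≈⟨ h ⟩
      z * z * (a * b + 1#) + 1#    ≈⟨ rhs ⟩
      z * z + common               ∎))
    (λ h → begin
      (a * z + 1#) * (b * z + 1#)  ≈⟨ lhs ⟩
      z * (a + b) + common         ≈⟨ +-congʳ h ⟩
      z * z + common               ≈⟨ rhs ⟨
      z * z * (a * b + 1#) + 1#    ∎)
    where
    common : Carrier
    common = z * z * (a * b) + 1#
    lhs : (a * z + 1#) * (b * z + 1#) ≈ z * (a + b) + common
    lhs = solve 3 (λ a b z → (a :* z :+ con 1) :* (b :* z :+ con 1)
                           := z :* (a :+ b) :+ (z :* z :* (a :* b) :+ con 1)) refl a b z
    rhs : z * z * (a * b + 1#) + 1# ≈ z * z + common
    rhs = solve 3 (λ a b z → z :* z :* (a :* b :+ con 1) :+ con 1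
                           := z :* z :+ (z :* z :* (a :* b) :+ con 1)) refl a b z

  -- With d = x + y − z, the two conditions read z·d = 0 and (z + 1)·d = 0.
  +≈⇔Robinson : ∀ x y z → x + y ≈ z ⇔ (Robinson x y z × Robinson (x + 1#) y (z + 1#))
  +≈⇔Robinson x y z = mk⇔
    (λ h → *-congˡ h , *-congˡ (trans shift (+-congʳ h)))
    (λ (h₀ , h₁) → ∙-cancelʳ (z * z + z + 1#) _ _ (begin
      (x + y) + (z * z + z + 1#)
        ≈⟨ solve 3 (λ x y z → (x :+ y) :+ (z :* z :+ z :+ con 1)
                           := z :* z :+ (z :+ (x :+ y) :+ con 1)) refl x y z ⟩
      z * z + (z + (x + y) + 1#)
        ≈⟨ +-congʳ h₀ ⟨
      z * (x + y) + (z + (x + y) + 1#)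
        ≈⟨ solve 3 (λ x y z → z :* (x :+ y) :+ (z :+ (x :+ y) :+ con 1)
                           := (z :+ con 1) :* ((x :+ con 1) :+ y)) refl x y z ⟩
      (z + 1#) * ((x + 1#) + y)
        ≈⟨ h₁ ⟩
      (z + 1#) * (z + 1#)
        ≈⟨ solve 1 (λ z → (z :+ con 1) :* (z :+ con 1) := z :+ (z :* z :+ z :+ con 1)) refl z ⟩
      z + (z * z + z + 1#)
        ∎))
    where
    shift : (x + 1#) + y ≈ (x + y) + 1#
    shift = solve 2 (λ x y → (x :+ con 1) :+ y := (x :+ y) :+ con 1) refl x y

  1≈-from-idempotent : ∀ w k → w + 1# ≈ k → w * w ≈ w → w * k ≈ w → 1# ≈ k
  1≈-from-idempotent w k w+1≈k w²≈w wk≈w = begin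
    1#      ≈⟨ +-identityˡ 1# ⟨
    0# + 1# ≈⟨ +-congʳ w≈0 ⟨
    w + 1#  ≈⟨ w+1≈k ⟩
    k       ∎
    where
    w²≈0 : w * w ≈ 0#
    w²≈0 = ∙-cancelʳ w _ _ (begin
      w * w + w     ≈⟨ solve 1 (λ w → w :* w :+ w := w :* (w :+ con 1)) refl w ⟩
      w * (w + 1#)  ≈⟨ *-congˡ w+1≈k ⟩
      w * k         ≈⟨ wk≈w ⟩
      w             ≈⟨ +-identityˡ w ⟨
      0# + w        ∎)
    w≈0 : w ≈ 0#
    w≈0 = trans (sym w²≈w) w²≈0

rename : {A B : Set} → (A → B) → REqn A → REqn B
rename ρ (succ≡ α γ)   = succ≡ (ρ α) (ρ γ)
rename ρ (prod≡ α β γ) = prod≡ (ρ α) (ρ β) (ρ γ)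

atoms : ∀ {n} → List (REqn (Fin n)) → RSystem n
atoms T = 0 , map (rename inj₁) T

infixr 4 _∧ᴿ_
_∧ᴿ_ : ∀ {n} → RSystem n → RSystem n → RSystem n
(k , T) ∧ᴿ (l , U) =
  k ℕ.+ l , map (rename (⊎-map₂ (_↑ˡ l))) T ++ map (rename (⊎-map₂ (k ↑ʳ_))) U

hideFirst : ∀ m {n k} → Fin (m ℕ.+ n) ⊎ Fin k → Fin n ⊎ Fin (m ℕ.+ k)
hideFirst m (inj₁ i) with splitAt m i
... | inj₁ a = inj₂ (a ↑ˡ _)
... | inj₂ b = inj₁ b
hideFirst m (inj₂ j) = inj₂ (m ↑ʳ j)

-- The first m free variables become additional ones.
∃ᴿ : ∀ m {n} → RSystem (m ℕ.+ n) → RSystem n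
∃ᴿ m (k , T) = m ℕ.+ k , map (rename (hideFirst m)) T

-- Both sides of (a z + 1)(b z + 1) = z² (a b + 1) + 1 are computed into L.
robinsonEqns : {V : Set} (a b z p p₁ q q₁ r r₁ s t L : V) → List (REqn V)
robinsonEqns a b z p p₁ q q₁ r r₁ s t L =
  prod≡ a z p ∷ succ≡ p p₁ ∷ prod≡ b z q ∷ succ≡ q q₁ ∷ prod≡ p₁ q₁ L ∷
  prod≡ a b r ∷ succ≡ r r₁ ∷ prod≡ z z s ∷ prod≡ s r₁ t ∷ succ≡ t L ∷ []

robinsonAtoms : ∀ {n} (a b z : Fin n) → List (REqn (Fin (9 ℕ.+ n)))
robinsonAtoms a b z = robinsonEqns (9 ↑ʳ a) (9 ↑ʳ b) (9 ↑ʳ z)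
  (# 0) (# 1) (# 2) (# 3) (# 4) (# 5) (# 6) (# 7) (# 8)

robinson : ∀ {n} (a b z : Fin n) → RSystem n
robinson a b z = ∃ᴿ 9 (atoms (robinsonAtoms a b z))

successorAtoms : ∀ {n} (a z : Fin n) → List (REqn (Fin (2 ℕ.+ n)))
successorAtoms a z = succ≡ (2 ↑ʳ a) (# 0) ∷ succ≡ (2 ↑ʳ z) (# 1) ∷ []

shiftedRobinson : ∀ {n} (a b z : Fin n) → RSystem n
shiftedRobinson a b z = ∃ᴿ 2 (atoms (successorAtoms a z) ∧ᴿ robinson (# 0) (2 ↑ʳ b) (# 1))

unitAtoms : ∀ {n} (k : Fin n) → List (REqn (Fin (1 ℕ.+ n)))
unitAtoms {n} k = succ≡ w (1 ↑ʳ k) ∷ prod≡ w w w ∷ prod≡ w (1 ↑ʳ k) w ∷ []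
  where
  w : Fin (1 ℕ.+ n)
  w = zero

encode : ∀ {n} → Eqn n → RSystem n
encode (one≡ k)     = ∃ᴿ 1 (atoms (unitAtoms k))
encode (add≡ i j k) = robinson i j k ∧ᴿ shiftedRobinson i j k
encode (mul≡ i j k) = atoms (prod≡ i j k ∷ [])

encodeSystem : ∀ {n} → System n → RSystem n
encodeSystem = foldr (λ e T → encode e ∧ᴿ T) (atoms [])

module _ {c ℓ : Level} (F : Field c ℓ) where
  open Field F
  open RingIdentities commutativeRing

  holdsR-rename : {A B : Set} {ρ : A → B} {v : B → Carrier} {u : A → Carrier} →
    (∀ a → v (ρ a) ≡ u a) → (e : REqn A) → holdsR F v (rename ρ e) ⇔ holdsR F u e
  holdsR-rename vρ≗u (succ≡ α γ)
    rewrite vρ≗u α | vρ≗u γ = mk⇔ id id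
  holdsR-rename vρ≗u (prod≡ α β γ)
    rewrite vρ≗u α | vρ≗u β | vρ≗u γ = mk⇔ id id

  All-holdsR-rename : {A B : Set} {ρ : A → B} {v : B → Carrier} {u : A → Carrier} →
    (∀ a → v (ρ a) ≡ u a) → (T : List (REqn A)) →
    All (holdsR F v) (map (rename ρ) T) ⇔ All (holdsR F u) T
  All-holdsR-rename vρ≗u T = mk⇔
    (All.map (λ {e} → to (holdsR-rename vρ≗u e)) ∘ map⁻)
    (map⁺ ∘ All.map (λ {e} → from (holdsR-rename vρ≗u e)))

  ExtSolvable-atoms : ∀ {n} (T : List (REqn (Fin n))) (x : Fin n → Carrier) →
    ExtSolvable F (proj₂ (atoms T)) x ⇔ All (holdsR F x) T
  ExtSolvable-atoms T x = mk⇔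
    (λ (_ , sat) → to (All-holdsR-rename (λ _ → ≡.refl) T) sat)
    (λ sat → (λ ()) , from (All-holdsR-rename (λ _ → ≡.refl) T) sat)

  ExtSolvable-∧ᴿ : ∀ {n} (T U : RSystem n) (x : Fin n → Carrier) →
    ExtSolvable F (proj₂ (T ∧ᴿ U)) x ⇔ (ExtSolvable F (proj₂ T) x × ExtSolvable F (proj₂ U) x)
  ExtSolvable-∧ᴿ (k , T) (l , U) x = mk⇔ split join
    where
    restrict : ∀ {m} (y : Fin m → Carrier) {j} (f : Fin j → Fin m) a →
      [ x , y ]′ (⊎-map₂ f a) ≡ [ x , y ∘ f ]′ a
    restrict y f (inj₁ i) = ≡.refl
    restrict y f (inj₂ j) = ≡.refl

    split : ExtSolvable F (proj₂ ((k , T) ∧ᴿ (l , U))) x → ExtSolvable F T x × ExtSolvable F U x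
    split (y , sat) with ++⁻ (map _ T) sat
    ... | satT , satU =
      (y ∘ (_↑ˡ l) , to (All-holdsR-rename (restrict y _) T) satT) ,
      (y ∘ (k ↑ʳ_) , to (All-holdsR-rename (restrict y _) U) satU)

    join : ExtSolvable F T x × ExtSolvable F U x → ExtSolvable F (proj₂ ((k , T) ∧ᴿ (l , U))) x
    join ((y , satT) , (w , satU)) =
      y Vector.++ w ,
      ++⁺ (from (All-holdsR-rename left T) satT) (from (All-holdsR-rename right U) satU)
      where
      left : ∀ a → [ x , y Vector.++ w ]′ (⊎-map₂ (_↑ˡ l) a) ≡ [ x , y ]′ a
      left (inj₁ i) = ≡.refl
      left (inj₂ j) = ≡.cong [ y , w ] (splitAt-↑ˡ k j l)
      right : ∀ a → [ x , y Vector.++ w ]′ (⊎-map₂ (k ↑ʳ_) a) ≡ [ x , w ]′ a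
      right (inj₁ i) = ≡.refl
      right (inj₂ j) = ≡.cong [ y , w ] (splitAt-↑ʳ k l j)

  ExtSolvable-∃ᴿ : ∀ m {n} (T : RSystem (m ℕ.+ n)) (x : Fin n → Carrier) →
    ExtSolvable F (proj₂ (∃ᴿ m T)) x ⇔
    Σ (Fin m → Carrier) (λ y → ExtSolvable F (proj₂ T) (y Vector.++ x))
  ExtSolvable-∃ᴿ m (k , T) x = mk⇔
    (λ (y , sat) → y ∘ (_↑ˡ k) , y ∘ (m ↑ʳ_) , to (All-holdsR-rename (unsplit y) T) sat)
    (λ (y , w , sat) → y Vector.++ w , from (All-holdsR-rename (resplit y w) T) sat)
    where
    unsplit : ∀ y a → [ x , y ]′ (hideFirst m a) ≡ [ (y ∘ (_↑ˡ k)) Vector.++ x , y ∘ (m ↑ʳ_) ]′ a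
    unsplit y (inj₁ i) with splitAt m i
    ... | inj₁ a = ≡.refl
    ... | inj₂ b = ≡.refl
    unsplit y (inj₂ j) = ≡.refl

    resplit : ∀ y w a → [ x , y Vector.++ w ]′ (hideFirst m a) ≡ [ y Vector.++ x , w ]′ a
    resplit y w (inj₁ i) with splitAt m i
    ... | inj₁ a = ≡.cong [ y , w ] (splitAt-↑ˡ m a k)
    ... | inj₂ b = ≡.refl
    resplit y w (inj₂ j) = ≡.cong [ y , w ] (splitAt-↑ʳ m k j)

  ExtSolvable-∃ᴿ-atoms : ∀ m {n} (T : List (REqn (Fin (m ℕ.+ n)))) (x : Fin n → Carrier) →
    ExtSolvable F (proj₂ (∃ᴿ m (atoms T))) x ⇔
    Σ (Fin m → Carrier) (λ y → All (holdsR F (y Vector.++ x)) T)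
  ExtSolvable-∃ᴿ-atoms m T x = mk⇔
    (λ sat → let (y , sat′) = to (ExtSolvable-∃ᴿ m _ x) sat in
             y , to (ExtSolvable-atoms T _) sat′)
    (λ (y , sat) → from (ExtSolvable-∃ᴿ m _ x) (y , from (ExtSolvable-atoms T _) sat))

  robinsonEqns-sound : {V : Set} (v : V → Carrier) {a b z p p₁ q q₁ r r₁ s t L : V} →
    All (holdsR F v) (robinsonEqns a b z p p₁ q q₁ r r₁ s t L) →
    (v a * v z + 1#) * (v b * v z + 1#) ≈ v z * v z * (v a * v b + 1#) + 1#
  robinsonEqns-sound v {a} {b} {z} {p} {p₁} {q} {q₁} {r} {r₁} {s} {t} {L}
    (az≈p ∷ p+1≈p₁ ∷ bz≈q ∷ q+1≈q₁ ∷ p₁q₁≈L ∷ ab≈r ∷ r+1≈r₁ ∷ zz≈s ∷ sr₁≈t ∷ t+1≈L ∷ []) = begin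
      (v a * v z + 1#) * (v b * v z + 1#)  ≈⟨ *-cong (+-congʳ az≈p) (+-congʳ bz≈q) ⟩
      (v p + 1#) * (v q + 1#)              ≈⟨ *-cong p+1≈p₁ q+1≈q₁ ⟩
      v p₁ * v q₁                          ≈⟨ p₁q₁≈L ⟩
      v L                                  ≈⟨ t+1≈L ⟨
      v t + 1#                             ≈⟨ +-congʳ sr₁≈t ⟨
      v s * v r₁ + 1#                      ≈⟨ +-congʳ (*-cong zz≈s (trans (+-congʳ ab≈r) r+1≈r₁)) ⟨
      v z * v z * (v a * v b + 1#) + 1#    ∎
    where open ≈-Reasoning setoid

  robinson-correct : ∀ {n} (a b z : Fin n) (x : Fin n → Carrier) →
    Robinson (x a) (x b) (x z) ⇔ ExtSolvable F (proj₂ (robinson a b z)) x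
  robinson-correct a b z x = mk⇔
    (λ h → from (ExtSolvable-∃ᴿ-atoms 9 (robinsonAtoms a b z) x) (witness ,
      refl ∷ refl ∷ refl ∷ refl ∷ refl ∷ refl ∷ refl ∷ refl ∷ refl ∷
      sym (from (robinson⇔ (x a) (x b) (x z)) h) ∷ []))
    (λ sat → let (y , eqns) = to (ExtSolvable-∃ᴿ-atoms 9 (robinsonAtoms a b z) x) sat in
      to (robinson⇔ (x a) (x b) (x z)) (robinsonEqns-sound (y Vector.++ x) eqns))
    where
    witness : Fin 9 → Carrier
    witness = lookup $
      x a * x z ∷ x a * x z + 1# ∷ x b * x z ∷ x b * x z + 1# ∷ x a * x b ∷ x a * x b + 1# ∷
      x z * x z ∷ x z * x z * (x a * x b + 1#) ∷ (x a * x z + 1#) * (x b * x z + 1#) ∷ []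

  shiftedRobinson-correct : ∀ {n} (a b z : Fin n) (x : Fin n → Carrier) →
    Robinson (x a + 1#) (x b) (x z + 1#) ⇔ ExtSolvable F (proj₂ (shiftedRobinson a b z)) x
  shiftedRobinson-correct {n} a b z x = mk⇔
    (λ h → from (ExtSolvable-∃ᴿ 2 core x) (shifts , from (ExtSolvable-∧ᴿ successors rob _)
      (from (ExtSolvable-atoms (successorAtoms a z) _) (refl ∷ refl ∷ []) ,
       to (robinson-correct (# 0) (2 ↑ʳ b) (# 1) _) h)))
    (λ sat → let (y , sat′) = to (ExtSolvable-∃ᴿ 2 core x) sat
                 (succs , robSat) = to (ExtSolvable-∧ᴿ successors rob _) sat′
             in shift y (to (ExtSolvable-atoms (successorAtoms a z) _) succs)
                  (from (robinson-correct (# 0) (2 ↑ʳ b) (# 1) _) robSat))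
    where
    successors rob core : RSystem (2 ℕ.+ n)
    successors = atoms (successorAtoms a z)
    rob = robinson (# 0) (2 ↑ʳ b) (# 1)
    core = successors ∧ᴿ rob
    shifts : Fin 2 → Carrier
    shifts = lookup (x a + 1# ∷ x z + 1# ∷ [])
    shift : ∀ y → All (holdsR F (y Vector.++ x)) (successorAtoms a z) →
      Robinson (y (# 0)) (x b) (y (# 1)) →
      Robinson (x a + 1#) (x b) (x z + 1#)
    shift y (a+1≈a′ ∷ z+1≈z′ ∷ []) = Robinson-resp (sym a+1≈a′) refl (sym z+1≈z′)

  encode-correct : ∀ {n} (e : Eqn n) (x : Fin n → Carrier) →
    holdsE F x e ⇔ ExtSolvable F (proj₂ (encode e)) x
  encode-correct (one≡ k) x = mk⇔
    (λ 1≈k → from (ExtSolvable-∃ᴿ-atoms 1 (unitAtoms k) x)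
      ((λ _ → 0#) , trans (+-identityˡ 1#) 1≈k ∷ zeroˡ 0# ∷ zeroˡ (x k) ∷ []))
    ((λ { (_ , (w+1≈k ∷ w²≈w ∷ wk≈w ∷ [])) → 1≈-from-idempotent _ _ w+1≈k w²≈w wk≈w })
      ∘′ to (ExtSolvable-∃ᴿ-atoms 1 (unitAtoms k) x))
  encode-correct (add≡ i j k) x = begin
    x i + x j ≈ x k
      ∼⟨ +≈⇔Robinson (x i) (x j) (x k) ⟩
    (Robinson (x i) (x j) (x k) × Robinson (x i + 1#) (x j) (x k + 1#))
      ∼⟨ robinson-correct i j k x ×-⇔ shiftedRobinson-correct i j k x ⟩
    (ExtSolvable F (proj₂ (robinson i j k)) x × ExtSolvable F (proj₂ (shiftedRobinson i j k)) x)
      ∼⟨ ⇔-sym (ExtSolvable-∧ᴿ (robinson i j k) (shiftedRobinson i j k) x) ⟩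
    ExtSolvable F (proj₂ (encode (add≡ i j k))) x ∎
    where open EquationalReasoning
  encode-correct (mul≡ i j k) x = mk⇔
    (λ ij≈k → from (ExtSolvable-atoms (prod≡ i j k ∷ []) x) (ij≈k ∷ []))
    (All.head ∘ to (ExtSolvable-atoms (prod≡ i j k ∷ []) x))

  encodeSystem-correct : ∀ {n} (S : System n) (x : Fin n → Carrier) →
    Solves F S x ⇔ ExtSolvable F (proj₂ (encodeSystem S)) x
  encodeSystem-correct []      x = mk⇔ (λ _ → (λ ()) , []) (λ _ → [])
  encodeSystem-correct (e ∷ S) x = begin
    Solves F (e ∷ S) x
      ∼⟨ mk⇔ All.uncons (uncurry _∷_) ⟩
    (holdsE F x e × Solves F S x)
      ∼⟨ encode-correct e x ×-⇔ encodeSystem-correct S x ⟩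
    (ExtSolvable F (proj₂ (encode e)) x × ExtSolvable F (proj₂ (encodeSystem S)) x)
      ∼⟨ ⇔-sym (ExtSolvable-∧ᴿ (encode e) (encodeSystem S) x) ⟩
    ExtSolvable F (proj₂ (encodeSystem (e ∷ S))) x ∎
    where open EquationalReasoning

lemma6 : (n : ℕ) (S : System n) →
    Σω ℕ (λ m → Σω (Fin m → RSystem n) (λ T →
      ∀ {c ℓ : Level} (F : Field c ℓ) (x : Fin n → Field.Carrier F) →
        Solves F S x ⇔ Σ (Fin m) (λ i → ExtSolvable F (proj₂ (T i)) x)))
lemma6 n S = 1 ,ω ((λ _ → encodeSystem S) ,ω λ F x → mk⇔
  (λ solves → zero , to (encodeSystem-correct F S x) solves)
  (λ (_ , sat) → from (encodeSystem-correct F S x) sat))
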